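{- Let $S$ be a spider graph comprised of exactly $\ell_1$ legs of length $1$, $\ell_2$ legs of length $2$, and $\ell_3$ legs of length $3$ (and no other legs), where $\ell_1,\ell_2,\ell_3\ge 0$. If $\ell_1>0$, then $$D(S,x)=x(1+x)^{\ell_1}(2x+x^2)^{\ell_2}(2x+3x^2+x^3)^{\ell_3}+x^{\ell_1}(2x+x^2)^{\ell_2}(x+3x^2+x^3)^{\ell_3}.$$ If $\ell_1=0$, then $$D(S,x)=x(2x+x^2)^{\ell_2}(2x+3x^2+x^3)^{\ell_3}+(2x+x^2)^{\ell_2}(x+3x^2+x^3)^{\ell_3}-x^{\ell_2}(x+x^2)^{\ell_3}.$$
   Context: The spider graph $S(\lambda_1,\ldots,\lambda_t)$ is formed by taking $t$ vertex-disjoint paths on $\lambda_1,\ldots,\lambda_t$ vertices and an additional central vertex joined by an edge to one endpoint of each path; each such path is a leg of length $\lambda_i$. A set $U$ of vertices is dominating if every vertex is in $U$ or adjacent to a vertex of $U$; $d_i(S)$ is the number of dominating sets of size $i$ and $D(S,x)=\sum_i d_i(S)x^i$ is the domination polynomial. -}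

module Defs where

open import Data.Bool using (Bool; true; false; _∧_; _∨_; if_then_else_)
open import Data.Nat as ℕ using (ℕ; zero; suc; _≡ᵇ_)
open import Data.Integer as ℤ using (ℤ; +_)
open import Data.List using (List; []; _∷_; _++_; map; length; filter; upTo; concat; replicate)
open import Data.Bool.ListAction using (all; any)
open import Data.Product using (_×_; _,_)
open import Relation.Binary.PropositionalEquality using (_≡_)
open import Relation.Nullary.Decidable using (T?)

-- A finite graph given by a duplicate-free list of vertices (vertices are
-- pairs of naturals) and a symmetric Boolean adjacency relation.
Vertex : Set
Vertex = ℕ × ℕ

_≟ᵛ_ : Vertex → Vertex → Bool
(a , b) ≟ᵛ (c , d) = (a ≡ᵇ c) ∧ (b ≡ᵇ d)

record Graph : Set where
  field
    vertices : List Vertex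
    adj      : Vertex → Vertex → Bool
open Graph public

memberB : Vertex → List Vertex → Bool
memberB v U = any (v ≟ᵛ_) U

dominatesB : Graph → List Vertex → Bool
dominatesB G U = all (λ v → memberB v U ∨ any (λ u → adj G u v) U) (vertices G)

-- All sub-lists (= subsets, since the vertex list has no duplicates).
subsets : List Vertex → List (List Vertex)
subsets []       = [] ∷ []
subsets (v ∷ vs) = let s = subsets vs in s ++ map (v ∷_) s

dcount : Graph → ℕ → ℕ
dcount G i = length (filter (λ U → T? ((length U ≡ᵇ i) ∧ dominatesB G U))
                            (subsets (vertices G)))

-- Polynomials with integer coefficients as coefficient lists
-- (constant term first); equality is coefficientwise.

Poly : Set
Poly = List ℤ

coeff : Poly → ℕ → ℤ
coeff []      _       = + 0
coeff (a ∷ p) zero    = a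
coeff (a ∷ p) (suc i) = coeff p i

infix  4 _≈ₚ_
infixl 6 _⊕_ _⊖_
infixl 7 _⊗_
infixr 8 _^ₚ_

_≈ₚ_ : Poly → Poly → Set
p ≈ₚ q = ∀ i → coeff p i ≡ coeff q i

_⊕_ : Poly → Poly → Poly
[]      ⊕ q       = q
(a ∷ p) ⊕ []      = a ∷ p
(a ∷ p) ⊕ (b ∷ q) = (a ℤ.+ b) ∷ (p ⊕ q)

negₚ : Poly → Poly
negₚ = map (λ a → ℤ.- a)

_⊖_ : Poly → Poly → Poly
p ⊖ q = p ⊕ negₚ q

_⊗_ : Poly → Poly → Poly
[]      ⊗ q = []
(a ∷ p) ⊗ q = map (a ℤ.*_) q ⊕ (+ 0 ∷ (p ⊗ q))

oneₚ : Poly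
oneₚ = + 1 ∷ []

_^ₚ_ : Poly → ℕ → Poly
p ^ₚ zero  = oneₚ
p ^ₚ suc n = p ⊗ (p ^ₚ n)

X : Poly
X = + 0 ∷ + 1 ∷ []

cst : ℕ → Poly
cst n = + n ∷ []

-- Domination polynomial D(G,x) = Σ_i d_i(G) x^i, i = 0 .. |V(G)|
-- (there are no dominating sets of size > |V(G)|).
domPoly : Graph → Poly
domPoly G = map (λ i → + dcount G i) (upTo (suc (length (vertices G))))

-- Spider graphs S(λ₁,…,λₜ)
-- Vertices: centre (0 , 0); for the j-th leg (j = 1..t) of length λⱼ the
-- vertices (j , 1), …, (j , λⱼ), where (j , 1) is adjacent to the centre
-- and (j , k) is adjacent to (j , k+1).

legVerts : ℕ → ℕ → List Vertex
legVerts j len = map (λ k → (j , suc k)) (upTo len)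

legsVerts : ℕ → List ℕ → List Vertex
legsVerts j []       = []
legsVerts j (len ∷ λs) = legVerts j len ++ legsVerts (suc j) λs

adjSpider : Vertex → Vertex → Bool
adjSpider (zero  , _) (suc j , k) = k ≡ᵇ 1
adjSpider (suc j , k) (zero  , _) = k ≡ᵇ 1
adjSpider (suc i , k) (suc j , l) = (i ≡ᵇ j) ∧ ((suc k ≡ᵇ l) ∨ (suc l ≡ᵇ k))
adjSpider (zero  , _) (zero  , _) = false

spider : List ℕ → Graph
spider λs = record { vertices = (0 , 0) ∷ legsVerts 1 λs ; adj = adjSpider }

-- Split the subsets U of the vertex set by the centre c.  If c ∈ U, then c dominates itself and
-- the first vertex of every leg, so U dominates iff on every leg the other vertices are dominated
-- from inside that leg; the legs are independent and contribute x ∏ A_λ.  If c ∉ U, every leg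
-- must be dominated from inside itself and U must meet N(c): dropping the last condition gives
-- ∏ B_λ, and the sets violating it are counted by ∏ C_λ.  So D(S,x) = x ∏ A_λ + ∏ B_λ − ∏ C_λ for
-- every spider.  For λ = 1, 2, 3 one computes A = 1+x, 2x+x², 2x+3x²+x³; B = x, 2x+x², x+3x²+x³;
-- C = 0, x, x+x²; and C₁ = 0 kills the last product as soon as ℓ₁ > 0.

module Submission where

open import Defs
open import Algebra.Structures using (IsCommutativeMonoid)
open import Data.Bool using (Bool; true; false; _∧_; _∨_; not; if_then_else_; T)
open import Data.Bool.ListAction using (all; any; and; or)
open import Data.Bool.Properties using (∨-assoc; ∨-identityʳ; ∨-zeroʳ; ∧-assoc; ∧-identityʳ; ∧-zeroʳ; T-∧)
open import Data.Integer using (ℤ; +_; _+_; _*_; -_)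
import Data.Integer.Properties as ℤ
open import Data.Integer.Solver using (module +-*-Solver)
open import Data.List using (List; []; _∷_; _++_; map; length; filter; foldr; replicate; upTo; applyUpTo)
open import Data.List.Properties using (length-++; length-map; map-∘; map-++; map-upTo; filter-none)
open import Data.List.Relation.Unary.All as All using (All; []; _∷_)
open import Data.List.Relation.Unary.All.Properties using (++⁺; map⁺)
open import Data.List.Relation.Binary.Permutation.Propositional using (_↭_; ↭⇒↭ₛ′)
import Data.List.Relation.Binary.Permutation.Propositional.Properties as ↭
open import Data.Nat as ℕ using (ℕ; zero; suc; _>_; _≡ᵇ_; _<_; _≤_; s≤s; z≤n; _<?_)
open import Data.Nat.Properties using (>⇒≢; <⇒≢; ≤-<-trans; ≡ᵇ⇒≡; ≤-refl; ≤-trans; n≤1+n; m≤n⇒m≤1+n; ≮⇒≥)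
open import Data.Product using (_×_; _,_; proj₁; proj₂)
open import Function using (_∘_)
open import Function.Bundles using (Equivalence)
open import Relation.Binary using (IsEquivalence; Setoid)
import Relation.Binary.Reasoning.Setoid as SetoidReasoning
open import Relation.Binary.PropositionalEquality
open import Relation.Nullary using (¬_)
open import Relation.Nullary.Decidable using (T?; yes; no; dec-true; dec-false)

-- Polynomial arithmetic

-- A record, so that both polynomials stay inferable from an equation.
infix 4 _≋_
record _≋_ (p q : Poly) : Set where
  constructor coeffwise
  field coeff-≡ : p ≈ₚ q
open _≋_ public

≋-refl : ∀ {p} → p ≋ p
≋-refl = coeffwise λ _ → refl

≋-sym : ∀ {p q} → p ≋ q → q ≋ p
≋-sym (coeffwise e) = coeffwise λ i → sym (e i)

≋-trans : ∀ {p q r} → p ≋ q → q ≋ r → p ≋ r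
≋-trans (coeffwise e) (coeffwise f) = coeffwise λ i → trans (e i) (f i)

≡⇒≋ : ∀ {p q} → p ≡ q → p ≋ q
≡⇒≋ refl = ≋-refl

≋-isEquivalence : IsEquivalence _≋_
≋-isEquivalence = record { refl = ≋-refl ; sym = ≋-sym ; trans = ≋-trans }

≋-setoid : Setoid _ _
≋-setoid = record { isEquivalence = ≋-isEquivalence }

module ≋-Reasoning = SetoidReasoning ≋-setoid

scale : ℤ → Poly → Poly
scale a = map (a *_)

coeff-⊕ : ∀ p q i → coeff (p ⊕ q) i ≡ coeff p i + coeff q i
coeff-⊕ []      q       i       = sym (ℤ.+-identityˡ _)
coeff-⊕ (a ∷ p) []      i       = sym (ℤ.+-identityʳ _)
coeff-⊕ (a ∷ p) (b ∷ q) zero    = refl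
coeff-⊕ (a ∷ p) (b ∷ q) (suc i) = coeff-⊕ p q i

coeff-negₚ : ∀ p i → coeff (negₚ p) i ≡ - coeff p i
coeff-negₚ []      i       = refl
coeff-negₚ (a ∷ p) zero    = refl
coeff-negₚ (a ∷ p) (suc i) = coeff-negₚ p i

coeff-scale : ∀ a p i → coeff (scale a p) i ≡ a * coeff p i
coeff-scale a []      i       = sym (ℤ.*-zeroʳ a)
coeff-scale a (b ∷ p) zero    = refl
coeff-scale a (b ∷ p) (suc i) = coeff-scale a p i

∷-cong : ∀ {a b p q} → a ≡ b → p ≋ q → a ∷ p ≋ b ∷ q
∷-cong {a} {b} {p} {q} a≡b (coeffwise e) = coeffwise coeffs
  where
  coeffs : a ∷ p ≈ₚ b ∷ q
  coeffs zero    = a≡b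
  coeffs (suc i) = e i

[]≋0∷[] : [] ≋ + 0 ∷ []
[]≋0∷[] = coeffwise λ { zero → refl ; (suc i) → refl }

⊕-cong : ∀ {p p′ q q′} → p ≋ p′ → q ≋ q′ → p ⊕ q ≋ p′ ⊕ q′
⊕-cong {p} {p′} {q} {q′} (coeffwise e) (coeffwise f) = coeffwise λ i → begin
  coeff (p ⊕ q) i         ≡⟨ coeff-⊕ p q i ⟩
  coeff p i + coeff q i   ≡⟨ cong₂ _+_ (e i) (f i) ⟩
  coeff p′ i + coeff q′ i ≡⟨ coeff-⊕ p′ q′ i ⟨
  coeff (p′ ⊕ q′) i       ∎
  where open ≡-Reasoning

⊕-comm : ∀ p q → p ⊕ q ≋ q ⊕ p
⊕-comm p q = coeffwise λ i → begin
  coeff (p ⊕ q) i       ≡⟨ coeff-⊕ p q i ⟩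
  coeff p i + coeff q i ≡⟨ ℤ.+-comm (coeff p i) (coeff q i) ⟩
  coeff q i + coeff p i ≡⟨ coeff-⊕ q p i ⟨
  coeff (q ⊕ p) i       ∎
  where open ≡-Reasoning

⊕-assoc : ∀ p q r → (p ⊕ q) ⊕ r ≋ p ⊕ (q ⊕ r)
⊕-assoc p q r = coeffwise λ i → begin
  coeff ((p ⊕ q) ⊕ r) i               ≡⟨ coeff-⊕ (p ⊕ q) r i ⟩
  coeff (p ⊕ q) i + coeff r i         ≡⟨ cong (_+ coeff r i) (coeff-⊕ p q i) ⟩
  (coeff p i + coeff q i) + coeff r i ≡⟨ ℤ.+-assoc (coeff p i) (coeff q i) (coeff r i) ⟩
  coeff p i + (coeff q i + coeff r i) ≡⟨ cong (λ x → coeff p i + x) (coeff-⊕ q r i) ⟨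
  coeff p i + coeff (q ⊕ r) i         ≡⟨ coeff-⊕ p (q ⊕ r) i ⟨
  coeff (p ⊕ (q ⊕ r)) i               ∎
  where open ≡-Reasoning

⊕-identityʳ : ∀ p → p ⊕ [] ≋ p
⊕-identityʳ p = coeffwise λ i → trans (coeff-⊕ p [] i) (ℤ.+-identityʳ (coeff p i))

⊕-interchange : ∀ p q r s → (p ⊕ q) ⊕ (r ⊕ s) ≋ (p ⊕ r) ⊕ (q ⊕ s)
⊕-interchange p q r s = begin
  (p ⊕ q) ⊕ (r ⊕ s) ≈⟨ ⊕-assoc p q (r ⊕ s) ⟩
  p ⊕ (q ⊕ (r ⊕ s)) ≈⟨ ⊕-cong (≋-refl {p}) (⊕-assoc q r s) ⟨
  p ⊕ ((q ⊕ r) ⊕ s) ≈⟨ ⊕-cong (≋-refl {p}) (⊕-cong (⊕-comm q r) (≋-refl {s})) ⟩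
  p ⊕ ((r ⊕ q) ⊕ s) ≈⟨ ⊕-cong (≋-refl {p}) (⊕-assoc r q s) ⟩
  p ⊕ (r ⊕ (q ⊕ s)) ≈⟨ ⊕-assoc p r (q ⊕ s) ⟨
  (p ⊕ r) ⊕ (q ⊕ s) ∎
  where open ≋-Reasoning

p≋q⊕r⇒q≋p⊖r : ∀ {p q r} → p ≋ q ⊕ r → q ≋ p ⊖ r
p≋q⊕r⇒q≋p⊖r {p} {q} {r} (coeffwise e) = coeffwise λ i → begin
  coeff q i                                 ≡⟨ solve 2 (λ x y → x := (x :+ y) :+ :- y) refl (coeff q i) (coeff r i) ⟩
  (coeff q i + coeff r i) + - coeff r i     ≡⟨ cong₂ (λ x y → x + y) (trans (sym (coeff-⊕ q r i)) (sym (e i))) (sym (coeff-negₚ r i)) ⟩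
  coeff p i + coeff (negₚ r) i              ≡⟨ coeff-⊕ p (negₚ r) i ⟨
  coeff (p ⊖ r) i                           ∎
  where open ≡-Reasoning
        open +-*-Solver

⊖-cong : ∀ {p p′ q q′} → p ≋ p′ → q ≋ q′ → p ⊖ q ≋ p′ ⊖ q′
⊖-cong {q = q} {q′} p≋p′ (coeffwise e) = ⊕-cong p≋p′ (coeffwise λ i →
  trans (coeff-negₚ q i) (trans (cong -_ (e i)) (sym (coeff-negₚ q′ i))))

scale-cong : ∀ a {p q} → p ≋ q → scale a p ≋ scale a q
scale-cong a {p} {q} (coeffwise e) = coeffwise λ i →
  trans (coeff-scale a p i) (trans (cong (a *_) (e i)) (sym (coeff-scale a q i)))

scale-⊕ : ∀ a p q → scale a (p ⊕ q) ≋ scale a p ⊕ scale a q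
scale-⊕ a p q = coeffwise λ i → begin
  coeff (scale a (p ⊕ q)) i                       ≡⟨ coeff-scale a (p ⊕ q) i ⟩
  a * coeff (p ⊕ q) i                             ≡⟨ cong (a *_) (coeff-⊕ p q i) ⟩
  a * (coeff p i + coeff q i)                     ≡⟨ ℤ.*-distribˡ-+ a (coeff p i) (coeff q i) ⟩
  a * coeff p i + a * coeff q i                   ≡⟨ cong₂ _+_ (coeff-scale a p i) (coeff-scale a q i) ⟨
  coeff (scale a p) i + coeff (scale a q) i       ≡⟨ coeff-⊕ (scale a p) (scale a q) i ⟨
  coeff (scale a p ⊕ scale a q) i                 ∎
  where open ≡-Reasoning

scale-scale : ∀ a b p → scale (a * b) p ≋ scale a (scale b p)
scale-scale a b p = coeffwise λ i → begin
  coeff (scale (a * b) p) i   ≡⟨ coeff-scale (a * b) p i ⟩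
  a * b * coeff p i           ≡⟨ ℤ.*-assoc a b (coeff p i) ⟩
  a * (b * coeff p i)         ≡⟨ cong (a *_) (coeff-scale b p i) ⟨
  a * coeff (scale b p) i     ≡⟨ coeff-scale a (scale b p) i ⟨
  coeff (scale a (scale b p)) i ∎
  where open ≡-Reasoning

scale-zero : ∀ p → scale (+ 0) p ≋ []
scale-zero p = coeffwise λ i → trans (coeff-scale (+ 0) p i) (ℤ.*-zeroˡ (coeff p i))

scale-shift : ∀ a p → scale a (+ 0 ∷ p) ≋ + 0 ∷ scale a p
scale-shift a p = ∷-cong (ℤ.*-zeroʳ a) ≋-refl

⊗-congʳ : ∀ p {q q′} → q ≋ q′ → p ⊗ q ≋ p ⊗ q′
⊗-congʳ []      q≋q′ = ≋-refl
⊗-congʳ (a ∷ p) q≋q′ = ⊕-cong (scale-cong a q≋q′) (∷-cong refl (⊗-congʳ p q≋q′))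

⊗-zeroʳ : ∀ p → p ⊗ [] ≋ []
⊗-zeroʳ []      = ≋-refl
⊗-zeroʳ (a ∷ p) = ≋-trans (∷-cong refl (⊗-zeroʳ p)) (≋-sym []≋0∷[])

⊗-distribˡ : ∀ p q r → p ⊗ (q ⊕ r) ≋ p ⊗ q ⊕ p ⊗ r
⊗-distribˡ []      q r = ≋-refl
⊗-distribˡ (a ∷ p) q r = begin
  scale a (q ⊕ r) ⊕ (+ 0 ∷ p ⊗ (q ⊕ r))
    ≈⟨ ⊕-cong (scale-⊕ a q r) (∷-cong refl (⊗-distribˡ p q r)) ⟩
  (scale a q ⊕ scale a r) ⊕ ((+ 0 ∷ p ⊗ q) ⊕ (+ 0 ∷ p ⊗ r))
    ≈⟨ ⊕-interchange (scale a q) (scale a r) (+ 0 ∷ p ⊗ q) (+ 0 ∷ p ⊗ r) ⟩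
  (scale a q ⊕ (+ 0 ∷ p ⊗ q)) ⊕ (scale a r ⊕ (+ 0 ∷ p ⊗ r)) ∎
  where open ≋-Reasoning

⊗-shiftʳ : ∀ p q → p ⊗ (+ 0 ∷ q) ≋ + 0 ∷ p ⊗ q
⊗-shiftʳ []      q = []≋0∷[]
⊗-shiftʳ (a ∷ p) q =
  ∷-cong (trans (ℤ.+-identityʳ (a * + 0)) (ℤ.*-zeroʳ a)) (⊕-cong (≋-refl {scale a q}) (⊗-shiftʳ p q))

⊗-constʳ : ∀ p a → p ⊗ (a ∷ []) ≋ scale a p
⊗-constʳ []      a = ≋-refl
⊗-constʳ (b ∷ p) a = ∷-cong (trans (ℤ.+-identityʳ (b * a)) (ℤ.*-comm b a)) (⊗-constʳ p a)

⊗-comm : ∀ p q → p ⊗ q ≋ q ⊗ p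
⊗-comm []      q = ≋-sym (⊗-zeroʳ q)
⊗-comm (a ∷ p) q = begin
  scale a q ⊕ (+ 0 ∷ p ⊗ q)          ≈⟨ ⊕-cong (≋-sym (⊗-constʳ q a)) (∷-cong refl (⊗-comm p q)) ⟩
  q ⊗ (a ∷ []) ⊕ (+ 0 ∷ q ⊗ p)       ≈⟨ ⊕-cong (≋-refl {q ⊗ (a ∷ [])}) (⊗-shiftʳ q p) ⟨
  q ⊗ (a ∷ []) ⊕ q ⊗ (+ 0 ∷ p)       ≈⟨ ⊗-distribˡ q (a ∷ []) (+ 0 ∷ p) ⟨
  q ⊗ ((a + + 0) ∷ p)                ≈⟨ ⊗-congʳ q (∷-cong (ℤ.+-identityʳ a) ≋-refl) ⟩
  q ⊗ (a ∷ p)                        ∎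
  where open ≋-Reasoning

⊗-congˡ : ∀ {p p′} q → p ≋ p′ → p ⊗ q ≋ p′ ⊗ q
⊗-congˡ {p} {p′} q p≋p′ = ≋-trans (⊗-comm p q) (≋-trans (⊗-congʳ q p≋p′) (⊗-comm q p′))

⊗-cong : ∀ {p p′ q q′} → p ≋ p′ → q ≋ q′ → p ⊗ q ≋ p′ ⊗ q′
⊗-cong {p′ = p′} {q = q} p≋p′ q≋q′ = ≋-trans (⊗-congˡ q p≋p′) (⊗-congʳ p′ q≋q′)

⊗-distribʳ : ∀ p q r → (p ⊕ q) ⊗ r ≋ p ⊗ r ⊕ q ⊗ r
⊗-distribʳ p q r = begin
  (p ⊕ q) ⊗ r     ≈⟨ ⊗-comm (p ⊕ q) r ⟩
  r ⊗ (p ⊕ q)     ≈⟨ ⊗-distribˡ r p q ⟩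
  r ⊗ p ⊕ r ⊗ q   ≈⟨ ⊕-cong (⊗-comm r p) (⊗-comm r q) ⟩
  p ⊗ r ⊕ q ⊗ r   ∎
  where open ≋-Reasoning

⊗-scaleˡ : ∀ a p q → scale a p ⊗ q ≋ scale a (p ⊗ q)
⊗-scaleˡ a []      q = ≋-refl
⊗-scaleˡ a (b ∷ p) q = begin
  scale (a * b) q ⊕ (+ 0 ∷ scale a p ⊗ q)
    ≈⟨ ⊕-cong (scale-scale a b q) (∷-cong refl (⊗-scaleˡ a p q)) ⟩
  scale a (scale b q) ⊕ (+ 0 ∷ scale a (p ⊗ q))
    ≈⟨ ⊕-cong (≋-refl {scale a (scale b q)}) (scale-shift a (p ⊗ q)) ⟨
  scale a (scale b q) ⊕ scale a (+ 0 ∷ p ⊗ q)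
    ≈⟨ scale-⊕ a (scale b q) (+ 0 ∷ p ⊗ q) ⟨
  scale a (scale b q ⊕ (+ 0 ∷ p ⊗ q)) ∎
  where open ≋-Reasoning

⊗-shiftˡ : ∀ p q → (+ 0 ∷ p) ⊗ q ≋ + 0 ∷ p ⊗ q
⊗-shiftˡ p q = ⊕-cong (scale-zero q) ≋-refl

⊗-assoc : ∀ p q r → (p ⊗ q) ⊗ r ≋ p ⊗ (q ⊗ r)
⊗-assoc []      q r = ≋-refl
⊗-assoc (a ∷ p) q r = begin
  (scale a q ⊕ (+ 0 ∷ p ⊗ q)) ⊗ r        ≈⟨ ⊗-distribʳ (scale a q) (+ 0 ∷ p ⊗ q) r ⟩
  scale a q ⊗ r ⊕ (+ 0 ∷ p ⊗ q) ⊗ r      ≈⟨ ⊕-cong (⊗-scaleˡ a q r) (⊗-shiftˡ (p ⊗ q) r) ⟩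
  scale a (q ⊗ r) ⊕ (+ 0 ∷ (p ⊗ q) ⊗ r)  ≈⟨ ⊕-cong (≋-refl {scale a (q ⊗ r)}) (∷-cong refl (⊗-assoc p q r)) ⟩
  scale a (q ⊗ r) ⊕ (+ 0 ∷ p ⊗ (q ⊗ r))  ∎
  where open ≋-Reasoning

⊗-identityʳ : ∀ p → p ⊗ oneₚ ≋ p
⊗-identityʳ p = ≋-trans (⊗-constʳ p (+ 1)) (coeffwise λ i → trans (coeff-scale (+ 1) p i) (ℤ.*-identityˡ (coeff p i)))

⊗-identityˡ : ∀ p → oneₚ ⊗ p ≋ p
⊗-identityˡ p = ≋-trans (⊗-comm oneₚ p) (⊗-identityʳ p)

⊗-isCommutativeMonoid : IsCommutativeMonoid _≋_ _⊗_ oneₚ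
⊗-isCommutativeMonoid = record
  { isMonoid = record
    { isSemigroup = record
      { isMagma = record { isEquivalence = ≋-isEquivalence ; ∙-cong = ⊗-cong }
      ; assoc   = ⊗-assoc }
    ; identity = ⊗-identityˡ , ⊗-identityʳ }
  ; comm = ⊗-comm }

^ₚ-+ : ∀ p m n → p ^ₚ (m ℕ.+ n) ≋ p ^ₚ m ⊗ p ^ₚ n
^ₚ-+ p zero    n = ≋-sym (⊗-identityˡ (p ^ₚ n))
^ₚ-+ p (suc m) n = ≋-trans (⊗-congʳ p (^ₚ-+ p m n)) (≋-sym (⊗-assoc p (p ^ₚ m) (p ^ₚ n)))

X⊗-shift : ∀ p → X ⊗ p ≋ + 0 ∷ p
X⊗-shift p = ≋-trans (⊗-shiftˡ oneₚ p) (∷-cong refl (⊗-identityˡ p))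

∑ : {A : Set} → List A → (A → Poly) → Poly
∑ []       f = []
∑ (x ∷ xs) f = f x ⊕ ∑ xs f

infix 5 ∑
syntax ∑ xs (λ x → e) = ∑[ x ∈ xs ] e

∑-++ : {A : Set} (xs ys : List A) (f : A → Poly) → ∑ (xs ++ ys) f ≋ ∑ xs f ⊕ ∑ ys f
∑-++ []       ys f = ≋-refl
∑-++ (x ∷ xs) ys f = ≋-trans (⊕-cong (≋-refl {f x}) (∑-++ xs ys f)) (≋-sym (⊕-assoc (f x) (∑ xs f) (∑ ys f)))

∑-map : {A B : Set} (g : A → B) (xs : List A) (f : B → Poly) → ∑ (map g xs) f ≡ ∑[ x ∈ xs ] f (g x)
∑-map g []       f = refl
∑-map g (x ∷ xs) f = cong (f (g x) ⊕_) (∑-map g xs f)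

∑-cong : {A : Set} {xs : List A} {f g : A → Poly} → All (λ x → f x ≋ g x) xs → ∑ xs f ≋ ∑ xs g
∑-cong []           = ≋-refl
∑-cong (fx≋gx ∷ es) = ⊕-cong fx≋gx (∑-cong es)

∑-⊕ : {A : Set} (xs : List A) (f g : A → Poly) → ∑[ x ∈ xs ] (f x ⊕ g x) ≋ ∑ xs f ⊕ ∑ xs g
∑-⊕ []       f g = ≋-refl
∑-⊕ (x ∷ xs) f g = ≋-trans (⊕-cong (≋-refl {f x ⊕ g x}) (∑-⊕ xs f g)) (⊕-interchange (f x) (g x) (∑ xs f) (∑ xs g))

⊗-∑ : {A : Set} (p : Poly) (xs : List A) (f : A → Poly) → p ⊗ ∑ xs f ≋ ∑[ x ∈ xs ] p ⊗ f x
⊗-∑ p []       f = ⊗-zeroʳ p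
⊗-∑ p (x ∷ xs) f = ≋-trans (⊗-distribˡ p (f x) (∑ xs f)) (⊕-cong (≋-refl {p ⊗ f x}) (⊗-∑ p xs f))

∑-⊗-∑ : {A B : Set} (xs : List A) (ys : List B) (f : A → Poly) (g : B → Poly) →
        ∑ xs f ⊗ ∑ ys g ≋ ∑[ x ∈ xs ] ∑[ y ∈ ys ] f x ⊗ g y
∑-⊗-∑ []       ys f g = ≋-refl
∑-⊗-∑ (x ∷ xs) ys f g = begin
  (f x ⊕ ∑ xs f) ⊗ ∑ ys g               ≈⟨ ⊗-distribʳ (f x) (∑ xs f) (∑ ys g) ⟩
  f x ⊗ ∑ ys g ⊕ ∑ xs f ⊗ ∑ ys g        ≈⟨ ⊕-cong (⊗-∑ (f x) ys g) (∑-⊗-∑ xs ys f g) ⟩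
  (∑[ y ∈ ys ] f x ⊗ g y) ⊕ (∑[ x′ ∈ xs ] ∑[ y ∈ ys ] f x′ ⊗ g y) ∎
  where open ≋-Reasoning

∏ : (ℕ → Poly) → List ℕ → Poly
∏ g xs = foldr _⊗_ oneₚ (map g xs)

∏-++ : ∀ g xs ys → ∏ g (xs ++ ys) ≋ ∏ g xs ⊗ ∏ g ys
∏-++ g []       ys = ≋-sym (⊗-identityˡ (∏ g ys))
∏-++ g (x ∷ xs) ys = ≋-trans (⊗-congʳ (g x) (∏-++ g xs ys)) (≋-sym (⊗-assoc (g x) (∏ g xs) (∏ g ys)))

∏-replicate : ∀ g n x → ∏ g (replicate n x) ≡ g x ^ₚ n
∏-replicate g zero    x = refl
∏-replicate g (suc n) x = cong (g x ⊗_) (∏-replicate g n x)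

∏-↭ : ∀ g {xs ys} → xs ↭ ys → ∏ g xs ≋ ∏ g ys
∏-↭ g xs↭ys = foldr-commMonoid ⊗-isCommutativeMonoid (↭⇒↭ₛ′ ≋-isEquivalence (↭.map⁺ g xs↭ys))
  where open import Data.List.Relation.Binary.Permutation.Setoid.Properties ≋-setoid using (foldr-commMonoid)

∑-subsets-++ : (xs ys : List Vertex) (f : List Vertex → Poly) →
  ∑ (subsets (xs ++ ys)) f ≋ ∑[ A ∈ subsets xs ] ∑[ B ∈ subsets ys ] f (A ++ B)
∑-subsets-++ []       ys f = ≋-sym (⊕-identityʳ (∑ (subsets ys) f))
∑-subsets-++ (x ∷ xs) ys f = begin
  ∑ (subsets (xs ++ ys) ++ map (x ∷_) (subsets (xs ++ ys))) f
    ≈⟨ ∑-++ (subsets (xs ++ ys)) (map (x ∷_) (subsets (xs ++ ys))) f ⟩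
  ∑ (subsets (xs ++ ys)) f ⊕ ∑ (map (x ∷_) (subsets (xs ++ ys))) f
    ≡⟨ cong (∑ (subsets (xs ++ ys)) f ⊕_) (∑-map (x ∷_) (subsets (xs ++ ys)) f) ⟩
  ∑ (subsets (xs ++ ys)) f ⊕ (∑[ U ∈ subsets (xs ++ ys) ] f (x ∷ U))
    ≈⟨ ⊕-cong (∑-subsets-++ xs ys f) (∑-subsets-++ xs ys (f ∘ (x ∷_))) ⟩
  ∑ (subsets xs) g ⊕ (∑[ A ∈ subsets xs ] g (x ∷ A))
    ≡⟨ cong (∑ (subsets xs) g ⊕_) (∑-map (x ∷_) (subsets xs) g) ⟨
  ∑ (subsets xs) g ⊕ ∑ (map (x ∷_) (subsets xs)) g
    ≈⟨ ∑-++ (subsets xs) (map (x ∷_) (subsets xs)) g ⟨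
  ∑ (subsets xs ++ map (x ∷_) (subsets xs)) g ∎
  where
  open ≋-Reasoning
  g : List Vertex → Poly
  g A = ∑[ B ∈ subsets ys ] f (A ++ B)

subsets-map : (f : Vertex → Vertex) (xs : List Vertex) → subsets (map f xs) ≡ map (map f) (subsets xs)
subsets-map f []       = refl
subsets-map f (x ∷ xs) = begin
  subsets (map f xs) ++ map (f x ∷_) (subsets (map f xs))
    ≡⟨ cong (λ S → S ++ map (f x ∷_) S) (subsets-map f xs) ⟩
  map (map f) S ++ map (f x ∷_) (map (map f) S)   ≡⟨ cong (map (map f) S ++_) (map-∘ S) ⟨
  map (map f) S ++ map (map f ∘ (x ∷_)) S         ≡⟨ cong (map (map f) S ++_) (map-∘ S) ⟩
  map (map f) S ++ map (map f) (map (x ∷_) S)     ≡⟨ map-++ (map f) S (map (x ∷_) S) ⟨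
  map (map f) (S ++ map (x ∷_) S)                 ∎
  where
  open ≡-Reasoning
  S : List (List Vertex)
  S = subsets xs

subsets-All : ∀ {P : Vertex → Set} {xs} → All P xs → All (All P) (subsets xs)
subsets-All []         = [] ∷ []
subsets-All (px ∷ pxs) = ++⁺ (subsets-All pxs) (map⁺ (All.map (px ∷_) (subsets-All pxs)))

length-subsets : ∀ xs → All (λ U → length U ≤ length xs) (subsets xs)
length-subsets []       = z≤n ∷ []
length-subsets (x ∷ xs) = ++⁺ (All.map m≤n⇒m≤1+n (length-subsets xs)) (map⁺ (All.map s≤s (length-subsets xs)))

any-++ : {A : Set} (p : A → Bool) (xs ys : List A) → any p (xs ++ ys) ≡ any p xs ∨ any p ys
any-++ p []       ys = refl
any-++ p (x ∷ xs) ys = trans (cong (p x ∨_) (any-++ p xs ys)) (sym (∨-assoc (p x) (any p xs) (any p ys)))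

all-++ : {A : Set} (p : A → Bool) (xs ys : List A) → all p (xs ++ ys) ≡ all p xs ∧ all p ys
all-++ p []       ys = refl
all-++ p (x ∷ xs) ys = trans (cong (p x ∧_) (all-++ p xs ys)) (sym (∧-assoc (p x) (all p xs) (all p ys)))

any-∨ : {A : Set} (p q : A → Bool) (xs : List A) → any p xs ∨ any q xs ≡ any (λ x → p x ∨ q x) xs
any-∨ p q []       = refl
any-∨ p q (x ∷ xs) rewrite sym (any-∨ p q xs) with p x | q x
... | true  | _     = refl
... | false | true  = ∨-zeroʳ (any p xs)
... | false | false = refl

any-cong : {A : Set} {p q : A → Bool} {xs : List A} → All (λ x → p x ≡ q x) xs → any p xs ≡ any q xs
any-cong []             = refl
any-cong (px≡qx ∷ eqs) = cong₂ _∨_ px≡qx (any-cong eqs)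

all-cong : {A : Set} {p q : A → Bool} {xs : List A} → All (λ x → p x ≡ q x) xs → all p xs ≡ all q xs
all-cong []             = refl
all-cong (px≡qx ∷ eqs) = cong₂ _∧_ px≡qx (all-cong eqs)

any-false : {A : Set} {p : A → Bool} {xs : List A} → All (λ x → p x ≡ false) xs → any p xs ≡ false
any-false []              = refl
any-false (px≡false ∷ eqs) rewrite px≡false = any-false eqs

any-map : {A B : Set} (p : B → Bool) (f : A → B) (xs : List A) → any p (map f xs) ≡ any (p ∘ f) xs
any-map p f xs = cong or (sym (map-∘ xs))

all-map : {A B : Set} (p : B → Bool) (f : A → B) (xs : List A) → all p (map f xs) ≡ all (p ∘ f) xs
all-map p f xs = cong and (sym (map-∘ xs))

-- Counting dominating sets

infix 8 x^_if_
x^_if_ : ℕ → Bool → Poly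
x^ n if b = if b then X ^ₚ n else []

coeff-X^ : ∀ n i → coeff (X ^ₚ n) i ≡ (if n ≡ᵇ i then + 1 else + 0)
coeff-X^ zero    zero    = refl
coeff-X^ zero    (suc i) = refl
coeff-X^ (suc n) zero    = coeff-≡ (X⊗-shift (X ^ₚ n)) zero
coeff-X^ (suc n) (suc i) = trans (coeff-≡ (X⊗-shift (X ^ₚ n)) (suc i)) (coeff-X^ n i)

coeff-x^if : ∀ n b i → coeff (x^ n if b) i ≡ (if (n ≡ᵇ i) ∧ b then + 1 else + 0)
coeff-x^if n true  i = trans (coeff-X^ n i) (cong (if_then + 1 else + 0) (sym (∧-identityʳ (n ≡ᵇ i))))
coeff-x^if n false i = cong (if_then + 1 else + 0) (sym (∧-zeroʳ (n ≡ᵇ i)))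

coeff-∑-x^if : (h : List Vertex → Bool) (Us : List (List Vertex)) (i : ℕ) →
  coeff (∑[ U ∈ Us ] x^ length U if h U) i ≡ + length (filter (λ U → T? ((length U ≡ᵇ i) ∧ h U)) Us)
coeff-∑-x^if h []       i = refl
coeff-∑-x^if h (U ∷ Us) i
  rewrite coeff-⊕ (x^ length U if h U) (∑[ V ∈ Us ] x^ length V if h V) i
        | coeff-x^if (length U) (h U) i
        | coeff-∑-x^if h Us i
  with (length U ≡ᵇ i) ∧ h U
... | true  = refl
... | false = ℤ.+-identityˡ _

x^if-∧ : ∀ m n a b → x^ (m ℕ.+ n) if (a ∧ b) ≋ x^ m if a ⊗ x^ n if b
x^if-∧ m n true  true  = ^ₚ-+ X m n
x^if-∧ m n true  false = ≋-sym (⊗-zeroʳ (X ^ₚ m))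
x^if-∧ m n false b     = ≋-refl

x^if-suc : ∀ n b → x^ suc n if b ≋ X ⊗ x^ n if b
x^if-suc n true  = ≋-refl
x^if-suc n false = ≋-sym (⊗-zeroʳ X)

x^if-split : ∀ n h w → x^ n if w ≋ x^ n if (h ∧ w) ⊕ x^ n if (w ∧ not h)
x^if-split n true  true  = ≋-sym (⊕-identityʳ (X ^ₚ n))
x^if-split n true  false = ≋-refl
x^if-split n false true  = ≋-refl
x^if-split n false false = ≋-refl

coeff-applyUpTo-< : ∀ (f : ℕ → ℤ) {m i} → i < m → coeff (applyUpTo f m) i ≡ f i
coeff-applyUpTo-< f {suc m} {zero}  _         = refl
coeff-applyUpTo-< f {suc m} {suc i} (s≤s i<m) = coeff-applyUpTo-< (f ∘ suc) i<m

coeff-applyUpTo-≥ : ∀ (f : ℕ → ℤ) {m i} → m ≤ i → coeff (applyUpTo f m) i ≡ + 0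
coeff-applyUpTo-≥ f {zero}          _         = refl
coeff-applyUpTo-≥ f {suc m} {suc i} (s≤s m≤i) = coeff-applyUpTo-≥ (f ∘ suc) m≤i

domPoly≋∑ : ∀ G → domPoly G ≋ ∑[ U ∈ subsets (vertices G) ] x^ length U if dominatesB G U
domPoly≋∑ G = coeffwise λ i → trans (coeff-domPoly i) (sym (coeff-∑-x^if (dominatesB G) (subsets (vertices G)) i))
  where
  n : ℕ
  n = length (vertices G)

  no-large-dominating-set : ∀ {i} → n < i → dcount G i ≡ 0
  no-large-dominating-set {i} n<i = cong length (filter-none (λ U → T? (isDominatingOfSize U)) none)
    where
    isDominatingOfSize : List Vertex → Bool
    isDominatingOfSize U = (length U ≡ᵇ i) ∧ dominatesB G U
    none : All (λ U → ¬ T (isDominatingOfSize U)) (subsets (vertices G))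
    none = All.map (λ |U|≤n t → <⇒≢ (≤-<-trans |U|≤n n<i) (≡ᵇ⇒≡ _ i (proj₁ (Equivalence.to T-∧ t))))
                   (length-subsets (vertices G))

  coeff-domPoly : ∀ i → coeff (domPoly G) i ≡ + dcount G i
  coeff-domPoly i rewrite map-upTo (λ j → + dcount G j) (suc n) with i <? suc n
  ... | yes i<1+n = coeff-applyUpTo-< (λ j → + dcount G j) i<1+n
  ... | no  i≮1+n = trans (coeff-applyUpTo-≥ (λ j → + dcount G j) (≮⇒≥ i≮1+n))
                          (cong +_ (sym (no-large-dominating-set (≮⇒≥ i≮1+n))))

-- Spiders

leg position : Vertex → ℕ
leg      = proj₁
position = proj₂

covers : Vertex → Vertex → Bool
covers u v = (v ≟ᵛ u) ∨ adjSpider u v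

-- `covers` between two vertices of one leg; it reads positions only, so the polynomial of a leg
-- does not depend on which leg it is.
coversWithinLeg : Vertex → Vertex → Bool
coversWithinLeg u v =
  (position v ≡ᵇ position u) ∨ ((suc (position u) ≡ᵇ position v) ∨ (suc (position v) ≡ᵇ position u))

isCentreNeighbour : Vertex → Bool
isCentreNeighbour u = position u ≡ᵇ 1

-- How the centre c relates to a set U of leg vertices; the three cases yield A, B and C.
data CentreCase : Set where
  inside      : CentreCase
  outside     : CentreCase
  undominated : CentreCase   -- c ∉ U and U contains no neighbour of c

coveredByCentre : CentreCase → ℕ → Bool
coveredByCentre inside      k = k ≡ᵇ 1
coveredByCentre outside     _ = false
coveredByCentre undominated _ = false

coveredB : (Vertex → Vertex → Bool) → CentreCase → List Vertex → List Vertex → Bool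
coveredB cov s vs U = all (λ v → coveredByCentre s (position v) ∨ any (λ u → cov u v) U) vs

admissibleB : (Vertex → Vertex → Bool) → CentreCase → List Vertex → List Vertex → Bool
admissibleB cov inside      vs U = coveredB cov inside vs U
admissibleB cov outside     vs U = coveredB cov outside vs U
admissibleB cov undominated vs U = coveredB cov undominated vs U ∧ not (any isCentreNeighbour U)

admissiblePoly : (Vertex → Vertex → Bool) → CentreCase → List Vertex → Poly
admissiblePoly cov s L = ∑[ U ∈ subsets L ] x^ length U if admissibleB cov s L U

legPoly : CentreCase → ℕ → ℕ → Poly
legPoly s j len = admissiblePoly coversWithinLeg s (legVerts j len)

legsPoly : CentreCase → ℕ → List ℕ → Poly
legsPoly s j λs = admissiblePoly covers s (legsVerts j λs)

OnLeg Beyond : ℕ → Vertex → Set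
OnLeg  j v = leg v ≡ j
Beyond j v = j < leg v

legVerts-onLeg : ∀ j len → All (OnLeg j) (legVerts j len)
legVerts-onLeg j len = map⁺ (All.universal (λ _ → refl) (upTo len))

legsVerts-beyond : ∀ j λs → All (λ v → j ≤ leg v) (legsVerts j λs)
legsVerts-beyond j []         = []
legsVerts-beyond j (len ∷ λs) =
  ++⁺ (All.map (λ { refl → ≤-refl }) (legVerts-onLeg j len))
      (All.map (≤-trans (n≤1+n j)) (legsVerts-beyond (suc j) λs))

-- `does (m ℕ.≟ n)` is definitionally `m ≡ᵇ n`.
covers-sameLeg : ∀ j b d → covers (suc j , b) (suc j , d) ≡ coversWithinLeg (suc j , b) (suc j , d)
covers-sameLeg j b d rewrite dec-true (j ℕ.≟ j) refl = refl

covers-otherLeg : ∀ {i j} b d → i ≢ j → covers (suc i , b) (suc j , d) ≡ false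
covers-otherLeg {i} {j} b d i≢j
  rewrite dec-false (j ℕ.≟ i) (i≢j ∘ sym) | dec-false (i ℕ.≟ j) i≢j = refl

∧-∧-not-∨ : ∀ x y a b → (x ∧ y) ∧ not (a ∨ b) ≡ (x ∧ not a) ∧ (y ∧ not b)
∧-∧-not-∨ false y a     b = refl
∧-∧-not-∨ true  y true  b = ∧-zeroʳ y
∧-∧-not-∨ true  y false b = refl

module _ {j : ℕ} {L₁ L₂ A B : List Vertex}
         (L₁-on : All (OnLeg (suc j)) L₁) (L₂-beyond : All (Beyond (suc j)) L₂)
         (A-on : All (OnLeg (suc j)) A) (B-beyond : All (Beyond (suc j)) B) where

  private
    covered-onLeg : ∀ {v} → OnLeg (suc j) v →
                    any (λ u → covers u v) (A ++ B) ≡ any (λ u → coversWithinLeg u v) A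
    covered-onLeg {v = _ , d} refl = begin
      any (λ u → covers u (suc j , d)) (A ++ B)
        ≡⟨ any-++ _ A B ⟩
      any (λ u → covers u (suc j , d)) A ∨ any (λ u → covers u (suc j , d)) B
        ≡⟨ cong₂ _∨_ (any-cong (All.map (λ { {_ , b} refl → covers-sameLeg j b d }) A-on))
                     (any-false (All.map (λ { {suc i , b} (s≤s j<i) → covers-otherLeg b d (>⇒≢ j<i) }) B-beyond)) ⟩
      any (λ u → coversWithinLeg u (suc j , d)) A ∨ false
        ≡⟨ ∨-identityʳ _ ⟩
      any (λ u → coversWithinLeg u (suc j , d)) A ∎
      where open ≡-Reasoning

    covered-beyond : ∀ {v} → Beyond (suc j) v → any (λ u → covers u v) (A ++ B) ≡ any (λ u → covers u v) B
    covered-beyond {v = suc k , d} (s≤s j<k) =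
      trans (any-++ _ A B)
            (cong (_∨ _) (any-false (All.map (λ { {_ , b} refl → covers-otherLeg b d (<⇒≢ j<k) }) A-on)))

    coveredB-++ : ∀ s → coveredB covers s (L₁ ++ L₂) (A ++ B) ≡ coveredB coversWithinLeg s L₁ A ∧ coveredB covers s L₂ B
    coveredB-++ s = trans (all-++ _ L₁ L₂)
      (cong₂ _∧_ (all-cong (All.map (λ {v} on → cong (coveredByCentre s (position v) ∨_) (covered-onLeg on)) L₁-on))
                 (all-cong (All.map (λ {v} bey → cong (coveredByCentre s (position v) ∨_) (covered-beyond bey)) L₂-beyond)))

  admissibleB-++ : ∀ s → admissibleB covers s (L₁ ++ L₂) (A ++ B) ≡
                         admissibleB coversWithinLeg s L₁ A ∧ admissibleB covers s L₂ B
  admissibleB-++ inside      = coveredB-++ inside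
  admissibleB-++ outside     = coveredB-++ outside
  admissibleB-++ undominated = begin
    coveredB covers undominated (L₁ ++ L₂) (A ++ B) ∧ not (any isCentreNeighbour (A ++ B))
      ≡⟨ cong₂ (λ x y → x ∧ not y) (coveredB-++ undominated) (any-++ isCentreNeighbour A B) ⟩
    (coveredB coversWithinLeg undominated L₁ A ∧ coveredB covers undominated L₂ B)
      ∧ not (any isCentreNeighbour A ∨ any isCentreNeighbour B)
      ≡⟨ ∧-∧-not-∨ (coveredB coversWithinLeg undominated L₁ A) (coveredB covers undominated L₂ B) _ _ ⟩
    admissibleB coversWithinLeg undominated L₁ A ∧ admissibleB covers undominated L₂ B ∎
    where open ≡-Reasoning

toLeg : ℕ → Vertex → Vertex
toLeg k v = (k , position v)

coveredB-toLeg : ∀ s k L A →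
  coveredB coversWithinLeg s (map (toLeg k) L) (map (toLeg k) A) ≡ coveredB coversWithinLeg s L A
coveredB-toLeg s k L A = trans (all-map _ (toLeg k) L) (all-cong (All.universal pointwise L))
  where
  pointwise : ∀ v → coveredByCentre s (position v) ∨ any (λ u → coversWithinLeg u (toLeg k v)) (map (toLeg k) A)
                  ≡ coveredByCentre s (position v) ∨ any (λ u → coversWithinLeg u v) A
  pointwise v = cong (coveredByCentre s (position v) ∨_) (any-map _ (toLeg k) A)

admissibleB-toLeg : ∀ s k L A →
  admissibleB coversWithinLeg s (map (toLeg k) L) (map (toLeg k) A) ≡ admissibleB coversWithinLeg s L A
admissibleB-toLeg inside      k L A = coveredB-toLeg inside k L A
admissibleB-toLeg outside     k L A = coveredB-toLeg outside k L A
admissibleB-toLeg undominated k L A =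
  cong₂ (λ x y → x ∧ not y) (coveredB-toLeg undominated k L A) (any-map isCentreNeighbour (toLeg k) A)

admissiblePoly-toLeg : ∀ s k L → admissiblePoly coversWithinLeg s (map (toLeg k) L) ≋ admissiblePoly coversWithinLeg s L
admissiblePoly-toLeg s k L = begin
  admissiblePoly coversWithinLeg s L′
    ≡⟨ cong (λ S → ∑[ A ∈ S ] x^ length A if admissibleB coversWithinLeg s L′ A) (subsets-map (toLeg k) L) ⟩
  ∑[ A ∈ map (map (toLeg k)) (subsets L) ] x^ length A if admissibleB coversWithinLeg s L′ A
    ≡⟨ ∑-map (map (toLeg k)) (subsets L) _ ⟩
  ∑[ A ∈ subsets L ] x^ length (map (toLeg k) A) if admissibleB coversWithinLeg s L′ (map (toLeg k) A)
    ≈⟨ ∑-cong (All.universal relabel (subsets L)) ⟩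
  admissiblePoly coversWithinLeg s L ∎
  where
  open ≋-Reasoning
  L′ : List Vertex
  L′ = map (toLeg k) L
  relabel : ∀ A → x^ length (map (toLeg k) A) if admissibleB coversWithinLeg s L′ (map (toLeg k) A)
                ≋ x^ length A if admissibleB coversWithinLeg s L A
  relabel A = ≡⇒≋ (cong₂ x^_if_ (length-map (toLeg k) A) (admissibleB-toLeg s k L A))

legPoly-relabel : ∀ s j k len → legPoly s j len ≋ legPoly s k len
legPoly-relabel s j k len =
  ≋-trans (≋-sym (admissiblePoly-toLeg s k (legVerts j len)))
          (≡⇒≋ (cong (admissiblePoly coversWithinLeg s) (sym (map-∘ (upTo len)))))

legsPoly-∏ : ∀ s j λs → legsPoly s (suc j) λs ≋ ∏ (legPoly s 1) λs
legsPoly-∏ inside      j []         = ⊕-identityʳ oneₚ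
legsPoly-∏ outside     j []         = ⊕-identityʳ oneₚ
legsPoly-∏ undominated j []         = ⊕-identityʳ oneₚ
legsPoly-∏ s           j (len ∷ λs) = begin
  admissiblePoly covers s (L₁ ++ L₂)
    ≈⟨ ∑-subsets-++ L₁ L₂ _ ⟩
  ∑[ A ∈ subsets L₁ ] ∑[ B ∈ subsets L₂ ] x^ length (A ++ B) if admissibleB covers s (L₁ ++ L₂) (A ++ B)
    ≈⟨ ∑-cong (All.map (λ A-on → ∑-cong (All.map (factor A-on) (subsets-All L₂-beyond))) (subsets-All L₁-on)) ⟩
  ∑[ A ∈ subsets L₁ ] ∑[ B ∈ subsets L₂ ] (legTerm A ⊗ restTerm B)
    ≈⟨ ∑-⊗-∑ (subsets L₁) (subsets L₂) legTerm restTerm ⟨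
  legPoly s (suc j) len ⊗ legsPoly s (suc (suc j)) λs
    ≈⟨ ⊗-cong (legPoly-relabel s (suc j) 1 len) (legsPoly-∏ s (suc j) λs) ⟩
  legPoly s 1 len ⊗ ∏ (legPoly s 1) λs ∎
  where
  open ≋-Reasoning
  L₁ L₂ : List Vertex
  L₁ = legVerts (suc j) len
  L₂ = legsVerts (suc (suc j)) λs
  L₁-on : All (OnLeg (suc j)) L₁
  L₁-on = legVerts-onLeg (suc j) len
  L₂-beyond : All (Beyond (suc j)) L₂
  L₂-beyond = legsVerts-beyond (suc (suc j)) λs
  legTerm restTerm : List Vertex → Poly
  legTerm  A = x^ length A if admissibleB coversWithinLeg s L₁ A
  restTerm B = x^ length B if admissibleB covers s L₂ B
  factor : ∀ {A B} → All (OnLeg (suc j)) A → All (Beyond (suc j)) B →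
           x^ length (A ++ B) if admissibleB covers s (L₁ ++ L₂) (A ++ B) ≋ legTerm A ⊗ restTerm B
  factor {A} {B} A-on B-beyond = ≋-trans
    (≡⇒≋ (cong₂ x^_if_ (length-++ A) (admissibleB-++ L₁-on L₂-beyond A-on B-beyond s)))
    (x^if-∧ (length A) (length B) (admissibleB coversWithinLeg s L₁ A) (admissibleB covers s L₂ B))

dominatesB-spider : ∀ λs U → dominatesB (spider λs) U ≡ all (λ v → any (λ u → covers u v) U) (vertices (spider λs))
dominatesB-spider λs U = all-cong (All.universal (λ v → any-∨ (v ≟ᵛ_) (λ u → adjSpider u v) U) (vertices (spider λs)))

dominatesB-spider-inside : ∀ λs U → dominatesB (spider λs) ((0 , 0) ∷ U) ≡ admissibleB covers inside (legsVerts 1 λs) U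
dominatesB-spider-inside λs U =
  trans (dominatesB-spider λs ((0 , 0) ∷ U)) (all-cong (All.map (λ { {suc _ , _} _ → refl }) (legsVerts-beyond 1 λs)))

dominatesB-spider-outside : ∀ λs {U} → All (λ u → 1 ≤ leg u) U →
  dominatesB (spider λs) U ≡ any isCentreNeighbour U ∧ admissibleB covers outside (legsVerts 1 λs) U
dominatesB-spider-outside λs {U} U-legs =
  trans (dominatesB-spider λs U) (cong (_∧ admissibleB covers outside (legsVerts 1 λs) U) (any-cong (All.map (λ { {suc _ , _} _ → refl }) U-legs)))

∑-centre-out : ∀ λs → ∑[ U ∈ subsets (legsVerts 1 λs) ] x^ length U if dominatesB (spider λs) U
                      ≋ legsPoly outside 1 λs ⊖ legsPoly undominated 1 λs
∑-centre-out λs = p≋q⊕r⇒q≋p⊖r (begin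
  legsPoly outside 1 λs
    ≈⟨ ∑-cong (All.universal split (subsets L)) ⟩
  ∑[ U ∈ subsets L ] (x^ length U if (any isCentreNeighbour U ∧ admissibleB covers outside L U)
                      ⊕ x^ length U if admissibleB covers undominated L U)
    ≈⟨ ∑-⊕ (subsets L) _ _ ⟩
  (∑[ U ∈ subsets L ] x^ length U if (any isCentreNeighbour U ∧ admissibleB covers outside L U))
    ⊕ legsPoly undominated 1 λs
    ≈⟨ ⊕-cong (∑-cong (All.map dominating (subsets-All (legsVerts-beyond 1 λs)))) ≋-refl ⟩
  (∑[ U ∈ subsets L ] x^ length U if dominatesB (spider λs) U) ⊕ legsPoly undominated 1 λs ∎)
  where
  open ≋-Reasoning
  L : List Vertex
  L = legsVerts 1 λs
  split : ∀ U → x^ length U if admissibleB covers outside L U ≋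
                x^ length U if (any isCentreNeighbour U ∧ admissibleB covers outside L U)
                ⊕ x^ length U if admissibleB covers undominated L U
  split U = x^if-split (length U) (any isCentreNeighbour U) (admissibleB covers outside L U)
  dominating : ∀ {U} → All (λ u → 1 ≤ leg u) U →
               x^ length U if (any isCentreNeighbour U ∧ admissibleB covers outside L U)
               ≋ x^ length U if dominatesB (spider λs) U
  dominating {U} U-legs = ≡⇒≋ (cong (x^_if_ (length U)) (sym (dominatesB-spider-outside λs U-legs)))

∑-centre-in : ∀ λs → ∑[ U ∈ subsets (legsVerts 1 λs) ] x^ length ((0 , 0) ∷ U) if dominatesB (spider λs) ((0 , 0) ∷ U)
                     ≋ X ⊗ legsPoly inside 1 λs
∑-centre-in λs = ≋-trans (∑-cong (All.universal dominating (subsets L))) (≋-sym (⊗-∑ X (subsets L) _))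
  where
  L : List Vertex
  L = legsVerts 1 λs
  dominating : ∀ U → x^ suc (length U) if dominatesB (spider λs) ((0 , 0) ∷ U)
                     ≋ X ⊗ x^ length U if admissibleB covers inside L U
  dominating U = ≋-trans (≡⇒≋ (cong (x^_if_ (suc (length U))) (dominatesB-spider-inside λs U)))
                         (x^if-suc (length U) (admissibleB covers inside L U))

domPoly-spider : ∀ λs →
  domPoly (spider λs) ≋ X ⊗ legsPoly inside 1 λs ⊕ (legsPoly outside 1 λs ⊖ legsPoly undominated 1 λs)
domPoly-spider λs = begin
  domPoly (spider λs)
    ≈⟨ domPoly≋∑ (spider λs) ⟩
  ∑ (subsets L ++ map ((0 , 0) ∷_) (subsets L)) term
    ≈⟨ ∑-++ (subsets L) (map ((0 , 0) ∷_) (subsets L)) term ⟩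
  ∑ (subsets L) term ⊕ ∑ (map ((0 , 0) ∷_) (subsets L)) term
    ≈⟨ ⊕-cong (∑-centre-out λs) (≋-trans (≡⇒≋ (∑-map ((0 , 0) ∷_) (subsets L) term)) (∑-centre-in λs)) ⟩
  (legsPoly outside 1 λs ⊖ legsPoly undominated 1 λs) ⊕ X ⊗ legsPoly inside 1 λs
    ≈⟨ ⊕-comm (legsPoly outside 1 λs ⊖ legsPoly undominated 1 λs) (X ⊗ legsPoly inside 1 λs) ⟩
  X ⊗ legsPoly inside 1 λs ⊕ (legsPoly outside 1 λs ⊖ legsPoly undominated 1 λs) ∎
  where
  open ≋-Reasoning
  L : List Vertex
  L = legsVerts 1 λs
  term : List Vertex → Poly
  term U = x^ length U if dominatesB (spider λs) U

-- Spiders with legs of length at most 3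

∏-multiset : ∀ g ℓ₁ ℓ₂ ℓ₃ →
  ∏ g (replicate ℓ₁ 1 ++ replicate ℓ₂ 2 ++ replicate ℓ₃ 3) ≋ g 1 ^ₚ ℓ₁ ⊗ (g 2 ^ₚ ℓ₂ ⊗ g 3 ^ₚ ℓ₃)
∏-multiset g ℓ₁ ℓ₂ ℓ₃ = ≋-trans (∏-++ g (replicate ℓ₁ 1) (replicate ℓ₂ 2 ++ replicate ℓ₃ 3))
  (⊗-cong (≡⇒≋ (∏-replicate g ℓ₁ 1))
          (≋-trans (∏-++ g (replicate ℓ₂ 2) (replicate ℓ₃ 3))
                   (≡⇒≋ (cong₂ _⊗_ (∏-replicate g ℓ₂ 2) (∏-replicate g ℓ₃ 3)))))

legsProduct : CentreCase → ℕ → ℕ → ℕ → Poly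
legsProduct s ℓ₁ ℓ₂ ℓ₃ = legPoly s 1 1 ^ₚ ℓ₁ ⊗ (legPoly s 1 2 ^ₚ ℓ₂ ⊗ legPoly s 1 3 ^ₚ ℓ₃)

domPoly-spider₁₂₃ : ∀ ℓ₁ ℓ₂ ℓ₃ λs → λs ↭ replicate ℓ₁ 1 ++ replicate ℓ₂ 2 ++ replicate ℓ₃ 3 →
  domPoly (spider λs) ≋
    X ⊗ legsProduct inside ℓ₁ ℓ₂ ℓ₃ ⊕ (legsProduct outside ℓ₁ ℓ₂ ℓ₃ ⊖ legsProduct undominated ℓ₁ ℓ₂ ℓ₃)
domPoly-spider₁₂₃ ℓ₁ ℓ₂ ℓ₃ λs λs↭ = ≋-trans (domPoly-spider λs)
  (⊕-cong (⊗-congʳ X (legs inside)) (⊖-cong (legs outside) (legs undominated)))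
  where
  legs : ∀ s → legsPoly s 1 λs ≋ legsProduct s ℓ₁ ℓ₂ ℓ₃
  legs s = ≋-trans (legsPoly-∏ s 0 λs) (≋-trans (∏-↭ (legPoly s 1) λs↭) (∏-multiset (legPoly s 1) ℓ₁ ℓ₂ ℓ₃))

regroup-ℓ₁≡0 : ∀ a₂ a₃ b₂ b₃ c₂ c₃ →
  X ⊗ (oneₚ ⊗ (a₂ ⊗ a₃)) ⊕ (oneₚ ⊗ (b₂ ⊗ b₃) ⊖ oneₚ ⊗ (c₂ ⊗ c₃)) ≋ X ⊗ a₂ ⊗ a₃ ⊕ b₂ ⊗ b₃ ⊖ c₂ ⊗ c₃
regroup-ℓ₁≡0 a₂ a₃ b₂ b₃ c₂ c₃ = begin
  X ⊗ (oneₚ ⊗ (a₂ ⊗ a₃)) ⊕ (oneₚ ⊗ (b₂ ⊗ b₃) ⊖ oneₚ ⊗ (c₂ ⊗ c₃))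
    ≈⟨ ⊕-cong (⊗-congʳ X (⊗-identityˡ (a₂ ⊗ a₃))) (⊖-cong (⊗-identityˡ (b₂ ⊗ b₃)) (⊗-identityˡ (c₂ ⊗ c₃))) ⟩
  X ⊗ (a₂ ⊗ a₃) ⊕ (b₂ ⊗ b₃ ⊖ c₂ ⊗ c₃)
    ≈⟨ ⊕-cong (⊗-assoc X a₂ a₃) ≋-refl ⟨
  X ⊗ a₂ ⊗ a₃ ⊕ (b₂ ⊗ b₃ ⊖ c₂ ⊗ c₃)
    ≈⟨ ⊕-assoc (X ⊗ a₂ ⊗ a₃) (b₂ ⊗ b₃) (negₚ (c₂ ⊗ c₃)) ⟨
  X ⊗ a₂ ⊗ a₃ ⊕ b₂ ⊗ b₃ ⊖ c₂ ⊗ c₃ ∎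
  where open ≋-Reasoning

regroup-ℓ₁>0 : ∀ a₁ a₂ a₃ b₁ b₂ b₃ →
  X ⊗ (a₁ ⊗ (a₂ ⊗ a₃)) ⊕ (b₁ ⊗ (b₂ ⊗ b₃) ⊖ []) ≋ X ⊗ a₁ ⊗ a₂ ⊗ a₃ ⊕ b₁ ⊗ b₂ ⊗ b₃
regroup-ℓ₁>0 a₁ a₂ a₃ b₁ b₂ b₃ = begin
  X ⊗ (a₁ ⊗ (a₂ ⊗ a₃)) ⊕ (b₁ ⊗ (b₂ ⊗ b₃) ⊖ [])
    ≈⟨ ⊕-cong (≋-sym (⊗-assoc X a₁ (a₂ ⊗ a₃))) (⊕-identityʳ (b₁ ⊗ (b₂ ⊗ b₃))) ⟩
  X ⊗ a₁ ⊗ (a₂ ⊗ a₃) ⊕ b₁ ⊗ (b₂ ⊗ b₃)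
    ≈⟨ ⊕-cong (⊗-assoc (X ⊗ a₁) a₂ a₃) (⊗-assoc b₁ b₂ b₃) ⟨
  X ⊗ a₁ ⊗ a₂ ⊗ a₃ ⊕ b₁ ⊗ b₂ ⊗ b₃ ∎
  where open ≋-Reasoning

-- For lengths 1, 2, 3 the leg polynomials compute to the factors of the statement;
-- in particular legPoly undominated 1 1 is [], which empties the last product when ℓ₁ > 0.
lemma3p4 : (ℓ₁ ℓ₂ ℓ₃ : ℕ) (λs : List ℕ) →
    λs ↭ (replicate ℓ₁ 1 ++ replicate ℓ₂ 2 ++ replicate ℓ₃ 3) →
    (ℓ₁ > 0 →
      domPoly (spider λs) ≈ₚ
        X ⊗ (oneₚ ⊕ X) ^ₚ ℓ₁ ⊗ (cst 2 ⊗ X ⊕ X ^ₚ 2) ^ₚ ℓ₂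
          ⊗ (cst 2 ⊗ X ⊕ cst 3 ⊗ X ^ₚ 2 ⊕ X ^ₚ 3) ^ₚ ℓ₃
        ⊕ X ^ₚ ℓ₁ ⊗ (cst 2 ⊗ X ⊕ X ^ₚ 2) ^ₚ ℓ₂
          ⊗ (X ⊕ cst 3 ⊗ X ^ₚ 2 ⊕ X ^ₚ 3) ^ₚ ℓ₃)
    × (ℓ₁ ≡ 0 →
      domPoly (spider λs) ≈ₚ
        X ⊗ (cst 2 ⊗ X ⊕ X ^ₚ 2) ^ₚ ℓ₂
          ⊗ (cst 2 ⊗ X ⊕ cst 3 ⊗ X ^ₚ 2 ⊕ X ^ₚ 3) ^ₚ ℓ₃
        ⊕ (cst 2 ⊗ X ⊕ X ^ₚ 2) ^ₚ ℓ₂ ⊗ (X ⊕ cst 3 ⊗ X ^ₚ 2 ⊕ X ^ₚ 3) ^ₚ ℓ₃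
        ⊖ X ^ₚ ℓ₂ ⊗ (X ⊕ X ^ₚ 2) ^ₚ ℓ₃)
lemma3p4 zero    ℓ₂ ℓ₃ λs λs↭ = (λ ()) , λ _ → coeff-≡ (≋-trans (domPoly-spider₁₂₃ 0 ℓ₂ ℓ₃ λs λs↭)
  (regroup-ℓ₁≡0 (legPoly inside 1 2 ^ₚ ℓ₂)      (legPoly inside 1 3 ^ₚ ℓ₃)
                (legPoly outside 1 2 ^ₚ ℓ₂)     (legPoly outside 1 3 ^ₚ ℓ₃)
                (legPoly undominated 1 2 ^ₚ ℓ₂) (legPoly undominated 1 3 ^ₚ ℓ₃)))
lemma3p4 (suc m) ℓ₂ ℓ₃ λs λs↭ = (λ _ → coeff-≡ (≋-trans (domPoly-spider₁₂₃ (suc m) ℓ₂ ℓ₃ λs λs↭)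
  (regroup-ℓ₁>0 (legPoly inside 1 1 ^ₚ suc m)  (legPoly inside 1 2 ^ₚ ℓ₂)  (legPoly inside 1 3 ^ₚ ℓ₃)
                (legPoly outside 1 1 ^ₚ suc m) (legPoly outside 1 2 ^ₚ ℓ₂) (legPoly outside 1 3 ^ₚ ℓ₃)))) , λ ()
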